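{- Let $r$ be a complex number and $n\ge0$ an integer. Then $d_n^{(r)}(0)=\binom{r+\lfloor n/2\rfloor}{\lfloor n/2\rfloor}$.
   Context: For a complex number $a$ and integer $k\ge0$, $\binom{a}{k}=a(a-1)\cdots(a-k+1)/k!$. For a parameter $r$ and an integer $n\ge 0$, $d_n^{(r)}(x)=\sum_{k=0}^n\binom{x+r+k}{k}\binom{x-r}{n-k}$. -}

module Defs where

open import Level using (Level)
open import Data.Nat using (ℕ; zero; suc; _∸_)
open import Algebra.Bundles using (CommutativeRing)

-- Everything is developed over an arbitrary commutative ring R in which
-- every positive integer is invertible (e.g. R = ℂ).
module _ {c ℓ : Level} (R : CommutativeRing c ℓ) where
  open CommutativeRing R hiding (zero)

  ιℕ : ℕ → Carrier
  ιℕ zero    = 0#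
  ιℕ (suc m) = 1# + ιℕ m

  PosInverses : (ℕ → Carrier) → Set ℓ
  PosInverses inv = ∀ m → (ιℕ (suc m) * inv m) ≈ 1#

  module _ (inv : ℕ → Carrier) where

    falling : Carrier → ℕ → Carrier
    falling a zero    = 1#
    falling a (suc k) = falling a k * (a - ιℕ k)

    invFact : ℕ → Carrier
    invFact zero    = 1#
    invFact (suc k) = invFact k * inv k

    binom : Carrier → ℕ → Carrier
    binom a k = falling a k * invFact k

    sumTo : ℕ → (ℕ → Carrier) → Carrier
    sumTo zero    f = f zero
    sumTo (suc n) f = sumTo n f + f (suc n)

    d : ℕ → Carrier → Carrier → Carrier
    d n r x = sumTo n (λ k → binom (x + r + ιℕ k) k * binom (x - r) (n ∸ k))

{-# OPTIONS --safe #-}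

-- At x = 0 the sum d_n is the Cauchy convolution of u_k = C(r+k, k) and
-- v_j = C(-r, j), two hypergeometric sequences: (k+1) u_{k+1} = (r+1+k) u_k
-- and (j+1) v_{j+1} = -(r+j) v_j.  Splitting n d_n = Σ k u_k v_{n-k} +
-- Σ (n-k) u_k v_{n-k}, each half obeys a first-order recurrence, which gives
--   d_1 = d_0   and   (n+2) d_{n+2} = d_{n+1} + (2r+n+1) d_n.
-- The sequence d_{2m} = d_{2m+1} = C(r+m, m) satisfies these, because
-- (m+1) C(r+m+1, m+1) = (r+m+1) C(r+m, m); since every n+2 is invertible, the
-- recurrence determines d_n.

module Submission where

open import Defs
open import Level using (Level)
open import Data.Nat as Nat using (ℕ; zero; suc; _∸_; _≤_; z≤n; ⌊_/2⌋)
open import Data.Nat.Properties using (+-suc; ≤-refl; m≤n⇒m≤1+n; n∸n≡0; +-∸-assoc; m+[n∸m]≡n)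
open import Algebra.Bundles using (CommutativeRing)
open import Data.Product using (_×_; _,_; proj₁; proj₂)
open import Data.Sum using (_⊎_; inj₁; inj₂; [_,_]′)
open import Relation.Binary.PropositionalEquality as ≡ using (_≡_)

half-parity : ∀ n → n ≡ ⌊ n /2⌋ Nat.+ ⌊ n /2⌋ ⊎ n ≡ suc (⌊ n /2⌋ Nat.+ ⌊ n /2⌋)
half-parity zero          = inj₁ ≡.refl
half-parity (suc zero)    = inj₂ ≡.refl
half-parity (suc (suc n)) with half-parity n
... | inj₁ even = inj₁ (≡.cong suc (≡.trans (≡.cong suc even) (≡.sym (+-suc _ _))))
... | inj₂ odd  = inj₂ (≡.cong suc (≡.trans (≡.cong suc odd) (≡.cong suc (≡.sym (+-suc _ _)))))

module _ {c ℓ : Level} (R : CommutativeRing c ℓ) where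
  open CommutativeRing R hiding (zero)
  open import Algebra.Properties.Group +-group using (inverseˡ-unique; inverseʳ-unique; ∙-cancelʳ)
  open import Algebra.Properties.AbelianGroup +-abelianGroup using (⁻¹-∙-comm)
  open import Algebra.Solver.Ring.NaturalCoefficients.Default commutativeSemiring
  open import Relation.Binary.Reasoning.Setoid setoid

  private
    ι : ℕ → Carrier
    ι = ιℕ R

  ιℕ-+ : ∀ m n → ιℕ R (m Nat.+ n) ≈ ιℕ R m + ιℕ R n
  ιℕ-+ zero    n = sym (+-identityˡ _)
  ιℕ-+ (suc m) n = trans (+-congˡ (ιℕ-+ m n)) (sym (+-assoc _ _ _))

  +-1-cancel : ∀ a b → (a + (1# + b)) - 1# ≈ a + b
  +-1-cancel a b = begin
    (a + (1# + b)) - 1#   ≈⟨ solve 3 (λ a b m → (a :+ (con 1 :+ b)) :+ m := (a :+ b) :+ (con 1 :+ m)) refl a b (- 1#) ⟩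
    (a + b) + (1# - 1#)   ≈⟨ +-congˡ (-‿inverseʳ 1#) ⟩
    (a + b) + 0#          ≈⟨ +-identityʳ _ ⟩
    a + b                 ∎

  module _ (inv : ℕ → Carrier) where
    private
      ∑ : ℕ → (ℕ → Carrier) → Carrier
      ∑ = sumTo R inv

    sumTo-cong : ∀ n {f g : ℕ → Carrier} → (∀ k → k ≤ n → f k ≈ g k) → ∑ n f ≈ ∑ n g
    sumTo-cong zero    f≈g = f≈g 0 z≤n
    sumTo-cong (suc n) f≈g =
      +-cong (sumTo-cong n (λ k k≤n → f≈g k (m≤n⇒m≤1+n k≤n))) (f≈g (suc n) ≤-refl)

    sumTo-+ : ∀ n (f g : ℕ → Carrier) → ∑ n (λ k → f k + g k) ≈ ∑ n f + ∑ n g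
    sumTo-+ zero    f g = refl
    sumTo-+ (suc n) f g = trans (+-congʳ (sumTo-+ n f g))
      (solve 4 (λ a b c d → (a :+ b) :+ (c :+ d) := (a :+ c) :+ (b :+ d)) refl _ _ _ _)

    *-sumTo : ∀ n a (f : ℕ → Carrier) → a * ∑ n f ≈ ∑ n (λ k → a * f k)
    *-sumTo zero    a f = refl
    *-sumTo (suc n) a f = trans (distribˡ _ _ _) (+-congʳ (*-sumTo n a f))

    sumTo-suc : ∀ n (f : ℕ → Carrier) → ∑ (suc n) f ≈ f 0 + ∑ n (λ k → f (suc k))
    sumTo-suc zero    f = refl
    sumTo-suc (suc n) f = trans (+-congʳ (sumTo-suc n f)) (+-assoc _ _ _)

    sumTo-vanishes : ∀ n {f : ℕ → Carrier} → (∀ k → k ≤ n → f k ≈ 0#) → ∑ n f ≈ 0#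
    sumTo-vanishes zero    f≈0 = f≈0 0 z≤n
    sumTo-vanishes (suc n) f≈0 = begin
      ∑ n _ + _  ≈⟨ +-cong (sumTo-vanishes n (λ k k≤n → f≈0 k (m≤n⇒m≤1+n k≤n))) (f≈0 (suc n) ≤-refl) ⟩
      0# + 0#    ≈⟨ +-identityˡ 0# ⟩
      0#         ∎

    convolution : (ℕ → Carrier) → (ℕ → Carrier) → ℕ → Carrier
    convolution u v n = ∑ n (λ k → u k * v (n ∸ k))

    module ConvolutionRecurrence
      (α β : Carrier) (u v : ℕ → Carrier)
      (u-rec : ∀ k → ι (suc k) * u (suc k) ≈ (α + ι k) * u k)
      (v-rec : ∀ j → ι (suc j) * v (suc j) + (β + ι j) * v j ≈ 0#)
      where

      private
        D : ℕ → Carrier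
        D = convolution u v

      left right : ℕ → Carrier
      left  = convolution (λ k → ι k * u k) v
      right = convolution u (λ j → ι j * v j)

      left+right : ∀ n → left n + right n ≈ ι n * D n
      left+right n = begin
        left n + right n                           ≈⟨ sym (sumTo-+ n _ _) ⟩
        ∑ n (λ k → ι k * u k * v (n ∸ k) + u k * (ι (n ∸ k) * v (n ∸ k)))
                                                   ≈⟨ sumTo-cong n split ⟩
        ∑ n (λ k → ι n * (u k * v (n ∸ k)))        ≈⟨ sym (*-sumTo n _ _) ⟩
        ι n * D n                                  ∎
        where
        split : ∀ k → k ≤ n → ι k * u k * v (n ∸ k) + u k * (ι (n ∸ k) * v (n ∸ k)) ≈ ι n * (u k * v (n ∸ k))
        split k k≤n = begin
          ι k * u k * v (n ∸ k) + u k * (ι (n ∸ k) * v (n ∸ k))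
            ≈⟨ solve 4 (λ i a j b → i :* a :* b :+ a :* (j :* b) := (i :+ j) :* (a :* b)) refl (ι k) (u k) (ι (n ∸ k)) (v (n ∸ k)) ⟩
          (ι k + ι (n ∸ k)) * (u k * v (n ∸ k))    ≈⟨ *-congʳ (sym (ιℕ-+ k (n ∸ k))) ⟩
          ι (k Nat.+ (n ∸ k)) * (u k * v (n ∸ k))      ≈⟨ *-congʳ (reflexive (≡.cong ι (m+[n∸m]≡n k≤n))) ⟩
          ι n * (u k * v (n ∸ k))                  ∎

      left-zero : left 0 ≈ 0#
      left-zero = trans (*-congʳ (zeroˡ _)) (zeroˡ _)

      right-zero : right 0 ≈ 0#
      right-zero = trans (*-congˡ (zeroˡ _)) (zeroʳ _)

      left-suc : ∀ n → left (suc n) ≈ α * D n + left n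
      left-suc n = begin
        left (suc n)                                            ≈⟨ sumTo-suc n _ ⟩
        0# * u 0 * v (suc n) + ∑ n (λ k → ι (suc k) * u (suc k) * v (n ∸ k))
          ≈⟨ +-cong (trans (*-congʳ (zeroˡ _)) (zeroˡ _)) (sumTo-cong n (λ k _ → *-congʳ (u-rec k))) ⟩
        0# + ∑ n (λ k → (α + ι k) * u k * v (n ∸ k))            ≈⟨ +-identityˡ _ ⟩
        ∑ n (λ k → (α + ι k) * u k * v (n ∸ k))
          ≈⟨ sumTo-cong n (λ k _ → solve 4 (λ a i x y → (a :+ i) :* x :* y := a :* (x :* y) :+ i :* x :* y) refl α (ι k) (u k) (v (n ∸ k))) ⟩
        ∑ n (λ k → α * (u k * v (n ∸ k)) + ι k * u k * v (n ∸ k)) ≈⟨ sumTo-+ n _ _ ⟩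
        ∑ n (λ k → α * (u k * v (n ∸ k))) + left n               ≈⟨ +-congʳ (sym (*-sumTo n _ _)) ⟩
        α * D n + left n                                         ∎

      -- The top term of right (suc n) carries the weight ι 0 and drops out.
      right-suc : ∀ n → right (suc n) + (β * D n + right n) ≈ 0#
      right-suc n = begin
        (∑ n (λ k → u k * (ι (suc n ∸ k) * v (suc n ∸ k))) + u (suc n) * (ι (n ∸ n) * v (n ∸ n)))
          + (β * D n + right n)
          ≈⟨ +-cong (+-congˡ top≈0) (+-congʳ (*-sumTo n β _)) ⟩
        (∑ n (λ k → u k * (ι (suc n ∸ k) * v (suc n ∸ k))) + 0#)
          + (∑ n (λ k → β * (u k * v (n ∸ k))) + right n)
          ≈⟨ +-cong (+-identityʳ _) (sym (sumTo-+ n _ _)) ⟩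
        ∑ n (λ k → u k * (ι (suc n ∸ k) * v (suc n ∸ k)))
          + ∑ n (λ k → β * (u k * v (n ∸ k)) + u k * (ι (n ∸ k) * v (n ∸ k)))
          ≈⟨ sym (sumTo-+ n _ _) ⟩
        ∑ n (λ k → u k * (ι (suc n ∸ k) * v (suc n ∸ k))
                   + (β * (u k * v (n ∸ k)) + u k * (ι (n ∸ k) * v (n ∸ k))))
          ≈⟨ sumTo-vanishes n term≈0 ⟩
        0#  ∎
        where
        top≈0 : u (suc n) * (ι (n ∸ n) * v (n ∸ n)) ≈ 0#
        top≈0 = trans (*-congˡ (trans (*-congʳ (reflexive (≡.cong ι (n∸n≡0 n)))) (zeroˡ _))) (zeroʳ _)

        term≈0 : ∀ k → k ≤ n → u k * (ι (suc n ∸ k) * v (suc n ∸ k))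
                                + (β * (u k * v (n ∸ k)) + u k * (ι (n ∸ k) * v (n ∸ k))) ≈ 0#
        term≈0 k k≤n rewrite +-∸-assoc 1 k≤n = begin
          u k * (ι (suc j) * v (suc j)) + (β * (u k * v j) + u k * (ι j * v j))
            ≈⟨ solve 5 (λ a s b i w → a :* s :+ (b :* (a :* w) :+ a :* (i :* w)) := a :* (s :+ (b :+ i) :* w))
                 refl (u k) (ι (suc j) * v (suc j)) β (ι j) (v j) ⟩
          u k * (ι (suc j) * v (suc j) + (β + ι j) * v j) ≈⟨ *-congˡ (v-rec j) ⟩
          u k * 0#                                        ≈⟨ zeroʳ _ ⟩
          0#                                              ∎
          where j = n ∸ k

      -- Both sides equal - right (suc n).
      right-suc-suc : ∀ n → right (suc (suc n)) + β * D (suc n) ≈ β * D n + right n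
      right-suc-suc n = trans
        (inverseˡ-unique _ _ (trans (+-assoc _ _ _) (right-suc (suc n))))
        (sym (inverseʳ-unique _ _ (right-suc n)))

      convolution-rec₁ : ι 1 * D 1 + β * D 0 ≈ α * D 0
      convolution-rec₁ = begin
        ι 1 * D 1 + β * D 0                       ≈⟨ +-congʳ (sym (left+right 1)) ⟩
        left 1 + right 1 + β * D 0                ≈⟨ +-congʳ (+-congʳ (left-suc 0)) ⟩
        α * D 0 + left 0 + right 1 + β * D 0      ≈⟨ +-assoc _ _ _ ⟩
        (α * D 0 + left 0) + (right 1 + β * D 0)  ≈⟨ +-cong (+-congˡ left-zero) right-one ⟩
        (α * D 0 + 0#) + 0#                       ≈⟨ solve 1 (λ x → (x :+ con 0) :+ con 0 := x) refl (α * D 0) ⟩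
        α * D 0                                   ∎
        where
        right-one : right 1 + β * D 0 ≈ 0#
        right-one = trans (+-congˡ (sym (trans (+-congˡ right-zero) (+-identityʳ _)))) (right-suc 0)

      convolution-rec₂ : ∀ n → ι (suc (suc n)) * D (suc (suc n)) + β * D (suc n)
                              ≈ α * D (suc n) + ((α + β) + ι n) * D n
      convolution-rec₂ n = begin
        ι (suc (suc n)) * D (suc (suc n)) + β * D (suc n)
          ≈⟨ +-congʳ (sym (left+right (suc (suc n)))) ⟩
        left (suc (suc n)) + right (suc (suc n)) + β * D (suc n)
          ≈⟨ +-assoc _ _ _ ⟩
        left (suc (suc n)) + (right (suc (suc n)) + β * D (suc n))
          ≈⟨ +-cong (trans (left-suc (suc n)) (+-congˡ (left-suc n))) (right-suc-suc n) ⟩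
        α * D (suc n) + (α * D n + left n) + (β * D n + right n)
          ≈⟨ solve 6 (λ a b x y l h → a :* x :+ (a :* y :+ l) :+ (b :* y :+ h) := a :* x :+ ((a :+ b) :* y :+ (l :+ h)))
               refl α β (D (suc n)) (D n) (left n) (right n) ⟩
        α * D (suc n) + ((α + β) * D n + (left n + right n))
          ≈⟨ +-congˡ (+-congˡ (left+right n)) ⟩
        α * D (suc n) + ((α + β) * D n + ι n * D n)
          ≈⟨ +-congˡ (sym (distribʳ _ _ _)) ⟩
        α * D (suc n) + ((α + β) + ι n) * D n      ∎

    module _ (pinv : PosInverses R inv) where
      private
        fall : Carrier → ℕ → Carrier
        fall = falling R inv

        C : Carrier → ℕ → Carrier
        C = binom R inv

      ιℕ-suc-*-inv : ∀ k x → ι (suc k) * (x * inv k) ≈ x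
      ιℕ-suc-*-inv k x = begin
        ι (suc k) * (x * inv k)   ≈⟨ solve 3 (λ s x w → s :* (x :* w) := x :* (s :* w)) refl (ι (suc k)) x (inv k) ⟩
        x * (ι (suc k) * inv k)   ≈⟨ *-congˡ (pinv k) ⟩
        x * 1#                    ≈⟨ *-identityʳ x ⟩
        x                         ∎

      ιℕ-suc-*-cancelˡ : ∀ k {x y} → ι (suc k) * x ≈ ι (suc k) * y → x ≈ y
      ιℕ-suc-*-cancelˡ k {x} {y} eq = begin
        x                             ≈⟨ sym (ιℕ-suc-*-inv k x) ⟩
        ι (suc k) * (x * inv k)       ≈⟨ solve 3 (λ s x w → s :* (x :* w) := (s :* x) :* w) refl (ι (suc k)) x (inv k) ⟩
        (ι (suc k) * x) * inv k       ≈⟨ *-congʳ eq ⟩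
        (ι (suc k) * y) * inv k       ≈⟨ solve 3 (λ s y w → (s :* y) :* w := s :* (y :* w)) refl (ι (suc k)) y (inv k) ⟩
        ι (suc k) * (y * inv k)       ≈⟨ ιℕ-suc-*-inv k y ⟩
        y                             ∎

      falling-cong : ∀ {a b} k → a ≈ b → fall a k ≈ fall b k
      falling-cong zero    a≈b = refl
      falling-cong (suc k) a≈b = *-cong (falling-cong k a≈b) (+-congʳ a≈b)

      binom-cong : ∀ {a b} k → a ≈ b → C a k ≈ C b k
      binom-cong k a≈b = *-congʳ (falling-cong k a≈b)

      falling-suc : ∀ a k → fall a (suc k) ≈ a * fall (a - 1#) k
      falling-suc a zero = begin
        1# * (a - 0#)  ≈⟨ *-identityˡ _ ⟩
        a - 0#         ≈⟨ +-congˡ (sym (inverseˡ-unique _ _ (+-identityˡ 0#))) ⟩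
        a + 0#         ≈⟨ +-identityʳ a ⟩
        a              ≈⟨ sym (*-identityʳ a) ⟩
        a * 1#         ∎
      falling-suc a (suc k) = begin
        fall a (suc k) * (a - (1# + ι k))
          ≈⟨ *-cong (falling-suc a k) (+-congˡ (sym (⁻¹-∙-comm 1# (ι k)))) ⟩
        a * fall (a - 1#) k * (a + (- 1# - ι k))  ≈⟨ *-congˡ (sym (+-assoc _ _ _)) ⟩
        a * fall (a - 1#) k * ((a - 1#) - ι k)    ≈⟨ *-assoc _ _ _ ⟩
        a * fall (a - 1#) (suc k)                 ∎

      ιℕ-suc-*-binom-suc : ∀ a k → ι (suc k) * C a (suc k) ≈ a * C (a - 1#) k
      ιℕ-suc-*-binom-suc a k = begin
        ι (suc k) * (fall a (suc k) * (invFact R inv k * inv k))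
          ≈⟨ *-congˡ (*-congʳ (falling-suc a k)) ⟩
        ι (suc k) * (a * fall (a - 1#) k * (invFact R inv k * inv k))
          ≈⟨ *-congˡ (solve 4 (λ a f i w → a :* f :* (i :* w) := a :* (f :* i) :* w) refl a (fall (a - 1#) k) (invFact R inv k) (inv k)) ⟩
        ι (suc k) * (a * C (a - 1#) k * inv k)
          ≈⟨ ιℕ-suc-*-inv k _ ⟩
        a * C (a - 1#) k                          ∎

      ιℕ-suc-*-binom-suc′ : ∀ a k → ι (suc k) * C a (suc k) ≈ (a - ι k) * C a k
      ιℕ-suc-*-binom-suc′ a k = begin
        ι (suc k) * (fall a k * (a - ι k) * (invFact R inv k * inv k))
          ≈⟨ *-congˡ (solve 4 (λ f w i v → f :* w :* (i :* v) := w :* (f :* i) :* v) refl (fall a k) (a - ι k) (invFact R inv k) (inv k)) ⟩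
        ι (suc k) * ((a - ι k) * C a k * inv k)
          ≈⟨ ιℕ-suc-*-inv k _ ⟩
        (a - ι k) * C a k                         ∎

      module AtZero (r : Carrier) where
        d₀ : ℕ → Carrier
        d₀ n = d R inv n r 0#

        B : ℕ → Carrier
        B m = C (r + ι m) m

        private
          u v : ℕ → Carrier
          u k = C (0# + r + ι k) k
          v j = C (0# - r) j

          u-rec : ∀ k → ι (suc k) * u (suc k) ≈ ((r + 1#) + ι k) * u k
          u-rec k = trans (ιℕ-suc-*-binom-suc _ k) (*-cong
            (solve 2 (λ r i → con 0 :+ r :+ (con 1 :+ i) := (r :+ con 1) :+ i) refl r (ι k))
            (binom-cong k (+-1-cancel (0# + r) (ι k))))

          v-rec : ∀ j → ι (suc j) * v (suc j) + (r + ι j) * v j ≈ 0#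
          v-rec j = begin
            ι (suc j) * v (suc j) + (r + ι j) * v j      ≈⟨ +-congʳ (ιℕ-suc-*-binom-suc′ _ j) ⟩
            ((0# - r) - ι j) * v j + (r + ι j) * v j     ≈⟨ sym (distribʳ _ _ _) ⟩
            (((0# - r) - ι j) + (r + ι j)) * v j
              ≈⟨ *-congʳ (+-congʳ (trans (+-congʳ (+-identityˡ _)) (⁻¹-∙-comm r (ι j)))) ⟩
            (- (r + ι j) + (r + ι j)) * v j              ≈⟨ *-congʳ (-‿inverseˡ _) ⟩
            0# * v j                                     ≈⟨ zeroˡ _ ⟩
            0#                                           ∎

          open ConvolutionRecurrence (r + 1#) r u v u-rec v-rec

        d₀-one : d₀ 1 ≈ d₀ 0
        d₀-one = ιℕ-suc-*-cancelˡ 0 (∙-cancelʳ (r * d₀ 0) _ _ (begin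
          ι 1 * d₀ 1 + r * d₀ 0     ≈⟨ convolution-rec₁ ⟩
          (r + 1#) * d₀ 0           ≈⟨ solve 2 (λ r x → (r :+ con 1) :* x := (con 1 :+ con 0) :* x :+ r :* x) refl r (d₀ 0) ⟩
          ι 1 * d₀ 0 + r * d₀ 0     ∎))

        d₀-rec : ∀ n → ι (suc (suc n)) * d₀ (suc (suc n)) ≈ d₀ (suc n) + ((r + r) + ι (suc n)) * d₀ n
        d₀-rec n = ∙-cancelʳ (r * d₀ (suc n)) _ _ (begin
          ι (suc (suc n)) * d₀ (suc (suc n)) + r * d₀ (suc n)
            ≈⟨ convolution-rec₂ n ⟩
          (r + 1#) * d₀ (suc n) + (((r + 1#) + r) + ι n) * d₀ n
            ≈⟨ solve 4 (λ r i x y → (r :+ con 1) :* x :+ (((r :+ con 1) :+ r) :+ i) :* y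
                                  := x :+ ((r :+ r) :+ (con 1 :+ i)) :* y :+ r :* x) refl r (ι n) (d₀ (suc n)) (d₀ n) ⟩
          d₀ (suc n) + ((r + r) + ι (suc n)) * d₀ n + r * d₀ (suc n)  ∎)

        B-rec : ∀ m → ι (suc m) * B (suc m) ≈ (r + ι (suc m)) * B m
        B-rec m = trans (ιℕ-suc-*-binom-suc _ m) (*-congˡ (binom-cong m (+-1-cancel r (ι m))))

        B-rec-double : ∀ m → ((r + r) + ι (suc (suc (m Nat.+ m)))) * B m ≈ ι (suc (suc (m Nat.+ m))) * B (suc m)
        B-rec-double m = begin
          ((r + r) + ι (suc (suc (m Nat.+ m)))) * B m
            ≈⟨ *-congʳ (+-congˡ (+-congˡ (+-congˡ (ιℕ-+ m m)))) ⟩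
          ((r + r) + (1# + (1# + (ι m + ι m)))) * B m
            ≈⟨ solve 3 (λ r i x → ((r :+ r) :+ (con 1 :+ (con 1 :+ (i :+ i)))) :* x
                                := (r :+ (con 1 :+ i)) :* x :+ (r :+ (con 1 :+ i)) :* x) refl r (ι m) (B m) ⟩
          (r + ι (suc m)) * B m + (r + ι (suc m)) * B m
            ≈⟨ sym (+-cong (B-rec m) (B-rec m)) ⟩
          ι (suc m) * B (suc m) + ι (suc m) * B (suc m)
            ≈⟨ solve 2 (λ i x → (con 1 :+ i) :* x :+ (con 1 :+ i) :* x := (con 1 :+ (con 1 :+ (i :+ i))) :* x) refl (ι m) (B (suc m)) ⟩
          (1# + (1# + (ι m + ι m))) * B (suc m)
            ≈⟨ *-congʳ (+-congˡ (+-congˡ (sym (ιℕ-+ m m)))) ⟩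
          ι (suc (suc (m Nat.+ m))) * B (suc m)      ∎

        d₀-even-odd : ∀ m → d₀ (m Nat.+ m) ≈ B m × d₀ (suc (m Nat.+ m)) ≈ B m
        d₀-even-odd zero    = d₀≈B₀ , trans d₀-one d₀≈B₀
          where
          d₀≈B₀ : d₀ 0 ≈ B 0
          d₀≈B₀ = trans (*-congʳ (*-identityˡ 1#)) (*-identityˡ _)
        d₀-even-odd (suc m) rewrite +-suc m m = even , odd
          where
          n = m Nat.+ m
          ih = d₀-even-odd m

          even : d₀ (suc (suc n)) ≈ B (suc m)
          even = ιℕ-suc-*-cancelˡ (suc n) (begin
            ι (suc (suc n)) * d₀ (suc (suc n))              ≈⟨ d₀-rec n ⟩
            d₀ (suc n) + ((r + r) + ι (suc n)) * d₀ n       ≈⟨ +-cong (proj₂ ih) (*-congˡ (proj₁ ih)) ⟩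
            B m + ((r + r) + ι (suc n)) * B m
              ≈⟨ solve 3 (λ s i x → x :+ (s :+ i) :* x := (s :+ (con 1 :+ i)) :* x) refl (r + r) (ι (suc n)) (B m) ⟩
            ((r + r) + ι (suc (suc n))) * B m               ≈⟨ B-rec-double m ⟩
            ι (suc (suc n)) * B (suc m)                     ∎)

          odd : d₀ (suc (suc (suc n))) ≈ B (suc m)
          odd = ιℕ-suc-*-cancelˡ (suc (suc n)) (begin
            ι (suc (suc (suc n))) * d₀ (suc (suc (suc n)))  ≈⟨ d₀-rec (suc n) ⟩
            d₀ (suc (suc n)) + ((r + r) + ι (suc (suc n))) * d₀ (suc n)
              ≈⟨ +-cong even (*-congˡ (proj₂ ih)) ⟩
            B (suc m) + ((r + r) + ι (suc (suc n))) * B m   ≈⟨ +-congˡ (B-rec-double m) ⟩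
            B (suc m) + ι (suc (suc n)) * B (suc m)
              ≈⟨ solve 2 (λ i x → x :+ i :* x := (con 1 :+ i) :* x) refl (ι (suc (suc n))) (B (suc m)) ⟩
            ι (suc (suc (suc n))) * B (suc m)               ∎)

corollary2p2 : {c ℓ : Level} (R : CommutativeRing c ℓ) (inv : ℕ → CommutativeRing.Carrier R)
    → PosInverses R inv
    → (r : CommutativeRing.Carrier R) (n : ℕ)
    → CommutativeRing._≈_ R (d R inv n r (CommutativeRing.0# R))
        (binom R inv (CommutativeRing._+_ R r (ιℕ R ⌊ n /2⌋)) ⌊ n /2⌋)
corollary2p2 R inv pinv r n = [ even , odd ]′ (half-parity n)
  where
  open CommutativeRing R using (_≈_)
  open AtZero R inv pinv r using (d₀; B; d₀-even-odd)
  h = ⌊ n /2⌋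

  even : n ≡ h Nat.+ h → d₀ n ≈ B h
  even n≡2h = ≡.subst (λ k → d₀ k ≈ B h) (≡.sym n≡2h) (proj₁ (d₀-even-odd h))

  odd : n ≡ suc (h Nat.+ h) → d₀ n ≈ B h
  odd n≡2h+1 = ≡.subst (λ k → d₀ k ≈ B h) (≡.sym n≡2h+1) (proj₂ (d₀-even-odd h))
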